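{- For $p\in\{012,001\}$, we have $$C_p(x,y)=\frac{1-x+x^2-x^2y}{1-2x+x^2-x^2y}.$$
   Context: A Catalan word of length $n\geq 1$ is a word $w_1\ldots w_n$ over the non-negative integers with $w_1=0$ and $0\leq w_i\leq w_{i-1}+1$ for $2\leq i\leq n$; the empty word is the unique Catalan word of length $0$. A word $w$ contains the pattern $p=p_1\ldots p_k$ if there are indices $i_1<\cdots<i_k$ such that $w_{i_1}\ldots w_{i_k}$ is order-isomorphic to $p$ (for all $a,b$: $w_{i_a}<w_{i_b}$ iff $p_a<p_b$, and $w_{i_a}=w_{i_b}$ iff $p_a=p_b$); otherwise $w$ avoids $p$. $\mathcal{C}_n(p)$ is the set of Catalan words of length $n$ avoiding $p$. A descent of $w$ is an index $i$ with $w_i>w_{i+1}$. $C_p(x,y)=\sum_{n,k\geq 0}c_{n,k}x^ny^k$, where $c_{n,k}$ is the number of words in $\mathcal{C}_n(p)$ with exactly $k$ descents. -}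

module Defs where

open import Data.Bool using (Bool; true; false; _∧_; _∨_; not; if_then_else_)
open import Data.Nat using (ℕ; zero; suc; _<ᵇ_; _≡ᵇ_)
open import Data.Integer as ℤ using (ℤ; +_; -[1+_]; _-_)
open import Data.List using (List; []; _∷_; map; length; filter; concatMap; upTo; lookup; allFin)
open import Data.Bool.ListAction using (all; any)
open import Data.Fin using (Fin)
open import Relation.Nullary.Decidable using (Dec; yes; no)
open import Relation.Binary.PropositionalEquality using (_≡_; refl)
open import Data.Bool.Properties using (T?)
open import Data.Bool using (T)

_==_ : Bool → Bool → Bool
true  == b = b
false == b = not b

catalanFrom : ℕ → List ℕ → Bool
catalanFrom prev []       = true
catalanFrom prev (x ∷ xs) = (x <ᵇ suc (suc prev)) ∧ catalanFrom x xs

isCatalan : List ℕ → Bool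
isCatalan []       = true
isCatalan (x ∷ xs) = (x ≡ᵇ 0) ∧ catalanFrom x xs

wordsOver : ℕ → ℕ → List (List ℕ)
wordsOver m zero    = [] ∷ []
wordsOver m (suc n) = concatMap (λ x → map (x ∷_) (wordsOver m n)) (upTo m)

-- Catalan words of length n (every letter of such a word is < n,
-- so they all occur among words over {0,…,n-1})
catalanWords : ℕ → List (List ℕ)
catalanWords n = filter (λ w → T? (isCatalan w)) (wordsOver n n)

subseqs : ℕ → List ℕ → List (List ℕ)
subseqs zero    _        = [] ∷ []
subseqs (suc k) []       = []
subseqs (suc k) (x ∷ xs) = map (x ∷_) (subseqs k xs) ++′ subseqs (suc k) xs
  where
  open import Data.List renaming (_++_ to _++′_)

orderIso : List ℕ → List ℕ → Bool
orderIso u v with Data.Nat._≟_ (length u) (length v)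
... | no _  = false
... | yes eq = all (λ i → all (λ j → pairOK i j) (allFin (length u))) (allFin (length u))
  where
  open import Data.Fin using (cast)
  pairOK : Fin (length u) → Fin (length u) → Bool
  pairOK i j =
    let a = lookup u i ; b = lookup u j
        c = lookup v (cast eq i) ; d = lookup v (cast eq j)
    in ((a <ᵇ b) == (c <ᵇ d)) ∧ ((a ≡ᵇ b) == (c ≡ᵇ d))

contains : List ℕ → List ℕ → Bool
contains w p = any (λ s → orderIso s p) (subseqs (length p) w)

avoids : List ℕ → List ℕ → Bool
avoids w p = not (contains w p)

des : List ℕ → ℕ
des []           = 0
des (x ∷ [])     = 0
des (x ∷ y ∷ xs) = (if y <ᵇ x then 1 else 0) Data.Nat.+ des (y ∷ xs)

c : List ℕ → ℕ → ℕ → ℕ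
c p n k = length (filter (λ w → T? (avoids w p ∧ (des w ≡ᵇ k))) (catalanWords n))

-- Coefficient of xⁿyᵏ in (1 - 2x + x² - x²y) · C_p(x,y)
denomTimesC : List ℕ → ℕ → ℕ → ℤ
denomTimesC p zero k = + c p 0 k
denomTimesC p (suc zero) k = (+ c p 1 k) - (+ 2 ℤ.* + c p 0 k)
denomTimesC p (suc (suc n)) zero =
  ((+ c p (suc (suc n)) 0) - (+ 2 ℤ.* + c p (suc n) 0)) ℤ.+ (+ c p n 0)
denomTimesC p (suc (suc n)) (suc k) =
  (((+ c p (suc (suc n)) (suc k)) - (+ 2 ℤ.* + c p (suc n) (suc k))) ℤ.+ (+ c p n (suc k)))
    - (+ c p n k)

-- Coefficient of xⁿyᵏ in 1 - x + x² - x²y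
numer : ℕ → ℕ → ℤ
numer 0 0 = + 1
numer 1 0 = -[1+ 0 ]
numer 2 0 = + 1
numer 2 1 = -[1+ 0 ]
numer _ _ = + 0

-- For both patterns the nonempty avoiders of length n + 1 with k descents are counted by
-- C(n + 1, 2k + 1), and multiplying by the denominator turns this into Pascal's rule.
-- A Catalan word 0w avoids 012 iff w is binary, and then its descents are the factors 10;
-- such a word is determined by the 2k + 1 positions where the letter changes in 0w1, which
-- gives C(n + 1, 2k + 1). A Catalan word avoids 001 iff it is 0 1 … j followed by a
-- non-increasing word with letters at most j; such tails of length n − j with k descents are
-- counted by C(j, k) C(n − j, k), and summing over j gives C(n + 1, 2k + 1) by Chu–Vandermonde.
-- Whether a triple of letters is order-isomorphic to a pattern depends only on how its
-- letters compare, so it suffices to check the 27 triples over {0, 1, 2}.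
module Submission where

open import Defs
open import Data.Bool using (Bool; true; false; _∧_; _∨_; not; if_then_else_; T)
open import Data.Bool.ListAction using (any; all)
import Data.Bool.Properties as Bool
open import Data.Bool.Properties
  using (T?; ∧-assoc; ∨-assoc; ∧-zeroʳ; ∨-zeroʳ; ∧-distribˡ-∨; not-involutive)
open import Data.Empty using (⊥-elim)
open import Data.Fin using (Fin; toℕ; #_)
open import Data.Fin.Properties using (all?)
open import Data.List using (List; []; _∷_; map; length; filter; concatMap; applyUpTo; _++_)
open import Data.Nat
  using (ℕ; zero; suc; _+_; _*_; _∸_; _<_; _≤_; s≤s; z<s; s<s; _<ᵇ_; _≡ᵇ_; _<?_; _≤?_)
open import Data.Nat.Properties
open import Algebra.Properties.CommutativeSemigroup +-commutativeSemigroup using (interchange)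
open import Data.Product using (Σ-syntax; _×_; _,_; proj₁; proj₂)
open import Data.Sum using (_⊎_; inj₁; inj₂)
open import Data.Unit using (tt)
open import Function using (_∘_)
open import Relation.Binary.Definitions using (tri<; tri≈; tri>)
open import Relation.Binary.PropositionalEquality
open import Relation.Nullary.Decidable using (True; toWitness; yes; no)

n<ᵇn≡false : ∀ n → (n <ᵇ n) ≡ false
n<ᵇn≡false zero    = refl
n<ᵇn≡false (suc n) = n<ᵇn≡false n

n≡ᵇn≡true : ∀ n → (n ≡ᵇ n) ≡ true
n≡ᵇn≡true zero    = refl
n≡ᵇn≡true (suc n) = n≡ᵇn≡true n

<⇒<ᵇ≡true : ∀ {m n} → m < n → (m <ᵇ n) ≡ true
<⇒<ᵇ≡true {zero}  {suc n} _         = refl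
<⇒<ᵇ≡true {suc m} {suc n} (s≤s m<n) = <⇒<ᵇ≡true m<n

≥⇒<ᵇ≡false : ∀ {m n} → n ≤ m → (m <ᵇ n) ≡ false
≥⇒<ᵇ≡false {n = zero}        _         = refl
≥⇒<ᵇ≡false {suc m} {suc n} (s≤s n≤m) = ≥⇒<ᵇ≡false n≤m

<⇒≡ᵇ≡false : ∀ {m n} → m < n → (m ≡ᵇ n) ≡ false
<⇒≡ᵇ≡false {zero}  {suc n} _         = refl
<⇒≡ᵇ≡false {suc m} {suc n} (s≤s m<n) = <⇒≡ᵇ≡false m<n

>⇒≡ᵇ≡false : ∀ {m n} → n < m → (m ≡ᵇ n) ≡ false
>⇒≡ᵇ≡false {suc m} {zero}  _         = refl
>⇒≡ᵇ≡false {suc m} {suc n} (s≤s n<m) = >⇒≡ᵇ≡false n<m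

T-injective : ∀ {a b} → (T a → T b) → (T b → T a) → a ≡ b
T-injective {false} {false} _ _ = refl
T-injective {false} {true}  _ g = ⊥-elim (g tt)
T-injective {true}  {false} f _ = ⊥-elim (f tt)
T-injective {true}  {true}  _ _ = refl

T-∨ˡ : ∀ {a} b → T a → T (a ∨ b)
T-∨ˡ {true} _ _ = tt

T-∨ʳ : ∀ a {b} → T b → T (a ∨ b)
T-∨ʳ true  _ = tt
T-∨ʳ false h = h

T-∨⁻ : ∀ a {b} → T (a ∨ b) → T a ⊎ T b
T-∨⁻ true  _ = inj₁ tt
T-∨⁻ false h = inj₂ h

T-∧⁻ : ∀ a {b} → T (a ∧ b) → T a × T b
T-∧⁻ true h = tt , h

∧-redundantˡ : ∀ {a b} d → (T b → T a) → a ∧ (b ∧ d) ≡ b ∧ d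
∧-redundantˡ {a}     {false} d _   = ∧-zeroʳ a
∧-redundantˡ {false} {true}  d b⇒a = ⊥-elim (b⇒a tt)
∧-redundantˡ {true}  {true}  d _   = refl

T-any-mono : ∀ {A : Set} {f g : A → Bool} → (∀ z → T (f z) → T (g z)) →
  ∀ zs → T (any f zs) → T (any g zs)
T-any-mono f⇒g (z ∷ zs) h with T-∨⁻ _ h
... | inj₁ fz   = T-∨ˡ _ (f⇒g z fz)
... | inj₂ rest = T-∨ʳ _ (T-any-mono f⇒g zs rest)

record SameOrder (x y a b : ℕ) : Set where
  field
    lt  : (x <ᵇ y) ≡ (a <ᵇ b)
    gt  : (y <ᵇ x) ≡ (b <ᵇ a)
    eq  : (x ≡ᵇ y) ≡ (a ≡ᵇ b)
    eq′ : (y ≡ᵇ x) ≡ (b ≡ᵇ a)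
open SameOrder

sameOrder-sym : ∀ {x y a b} → SameOrder x y a b → SameOrder y x b a
sameOrder-sym s = record { lt = gt s ; gt = lt s ; eq = eq′ s ; eq′ = eq s }

<-sameOrder : ∀ {x y a b} → x < y → {a<b : True (a <? b)} → SameOrder x y a b
<-sameOrder x<y {a<b} = record
  { lt  = trans (<⇒<ᵇ≡true x<y) (sym (<⇒<ᵇ≡true a<b′))
  ; gt  = trans (≥⇒<ᵇ≡false (<⇒≤ x<y)) (sym (≥⇒<ᵇ≡false (<⇒≤ a<b′)))
  ; eq  = trans (<⇒≡ᵇ≡false x<y) (sym (<⇒≡ᵇ≡false a<b′))
  ; eq′ = trans (>⇒≡ᵇ≡false x<y) (sym (>⇒≡ᵇ≡false a<b′))
  }
  where a<b′ = toWitness a<b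

>-sameOrder : ∀ {x y a b} → y < x → {b<a : True (b <? a)} → SameOrder x y a b
>-sameOrder y<x {b<a} = sameOrder-sym (<-sameOrder y<x {b<a})

≡-sameOrder : ∀ {x y a} → x ≡ y → SameOrder x y a a
≡-sameOrder {x} {a = a} refl = record
  { lt  = trans (n<ᵇn≡false x) (sym (n<ᵇn≡false a))
  ; gt  = trans (n<ᵇn≡false x) (sym (n<ᵇn≡false a))
  ; eq  = trans (n≡ᵇn≡true x) (sym (n≡ᵇn≡true a))
  ; eq′ = trans (n≡ᵇn≡true x) (sym (n≡ᵇn≡true a))
  }

SameOrder₃ : ℕ → ℕ → ℕ → ℕ → ℕ → ℕ → Set
SameOrder₃ x y z a b c = SameOrder x y a b × SameOrder y z b c × SameOrder x z a c

standardize : ∀ x y z →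
  Σ[ a ∈ Fin 3 ] Σ[ b ∈ Fin 3 ] Σ[ c ∈ Fin 3 ] SameOrder₃ x y z (toℕ a) (toℕ b) (toℕ c)
standardize x y z with <-cmp x y | <-cmp y z
... | tri< x<y _ _ | tri< y<z _ _ =
  # 0 , # 1 , # 2 , <-sameOrder x<y , <-sameOrder y<z , <-sameOrder (<-trans x<y y<z)
... | tri< x<y _ _ | tri≈ _ y≡z _ =
  # 0 , # 1 , # 1 , <-sameOrder x<y , ≡-sameOrder y≡z , <-sameOrder (subst (x <_) y≡z x<y)
... | tri≈ _ x≡y _ | tri< y<z _ _ =
  # 0 , # 0 , # 1 , ≡-sameOrder x≡y , <-sameOrder y<z , <-sameOrder (subst (_< z) (sym x≡y) y<z)
... | tri≈ _ x≡y _ | tri≈ _ y≡z _ =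
  # 0 , # 0 , # 0 , ≡-sameOrder x≡y , ≡-sameOrder y≡z , ≡-sameOrder (trans x≡y y≡z)
... | tri≈ _ x≡y _ | tri> _ _ z<y =
  # 1 , # 1 , # 0 , ≡-sameOrder x≡y , >-sameOrder z<y , >-sameOrder (subst (z <_) (sym x≡y) z<y)
... | tri> _ _ y<x | tri≈ _ y≡z _ =
  # 1 , # 0 , # 0 , >-sameOrder y<x , ≡-sameOrder y≡z , >-sameOrder (subst (_< x) y≡z y<x)
... | tri> _ _ y<x | tri> _ _ z<y =
  # 2 , # 1 , # 0 , >-sameOrder y<x , >-sameOrder z<y , >-sameOrder (<-trans z<y y<x)
... | tri< x<y _ _ | tri> _ _ z<y with <-cmp x z
...   | tri< x<z _ _ = # 0 , # 2 , # 1 , <-sameOrder x<y , >-sameOrder z<y , <-sameOrder x<z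
...   | tri≈ _ x≡z _ = # 0 , # 1 , # 0 , <-sameOrder x<y , >-sameOrder z<y , ≡-sameOrder x≡z
...   | tri> _ _ z<x = # 1 , # 2 , # 0 , <-sameOrder x<y , >-sameOrder z<y , >-sameOrder z<x
standardize x y z | tri> _ _ y<x | tri< y<z _ _ with <-cmp x z
...   | tri< x<z _ _ = # 1 , # 0 , # 2 , >-sameOrder y<x , <-sameOrder y<z , <-sameOrder x<z
...   | tri≈ _ x≡z _ = # 1 , # 0 , # 1 , >-sameOrder y<x , <-sameOrder y<z , ≡-sameOrder x≡z
...   | tri> _ _ z<x = # 2 , # 0 , # 1 , >-sameOrder y<x , <-sameOrder y<z , >-sameOrder z<x

ComparisonInvariant : (ℕ → ℕ → ℕ → Bool) → Set
ComparisonInvariant P = ∀ {x y z a b c} → SameOrder₃ x y z a b c → P x y z ≡ P a b c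

comparisonInvariant-≡ : ∀ {P Q} → ComparisonInvariant P → ComparisonInvariant Q →
  (∀ (a b c : Fin 3) → P (toℕ a) (toℕ b) (toℕ c) ≡ Q (toℕ a) (toℕ b) (toℕ c)) →
  ∀ x y z → P x y z ≡ Q x y z
comparisonInvariant-≡ invP invQ onSmall x y z with standardize x y z
... | a , b , c , s = trans (invP s) (trans (onSmall a b c) (sym (invQ s)))

orderIso₃-invariant : ∀ p q r → ComparisonInvariant (λ x y z → orderIso (x ∷ y ∷ z ∷ []) (p ∷ q ∷ r ∷ []))
orderIso₃-invariant p q r {x} {y} {z} {a} {b} {c} (s , t , u)
  rewrite lt s | gt s | eq s | eq′ s | lt t | gt t | eq t | eq′ t | lt u | gt u | eq u | eq′ u
        | n<ᵇn≡false x | n<ᵇn≡false y | n<ᵇn≡false z | n<ᵇn≡false a | n<ᵇn≡false b | n<ᵇn≡false c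
        | n≡ᵇn≡true x | n≡ᵇn≡true y | n≡ᵇn≡true z | n≡ᵇn≡true a | n≡ᵇn≡true b | n≡ᵇn≡true c
        = refl

is012 : ℕ → ℕ → ℕ → Bool
is012 x y z = (x <ᵇ y) ∧ (y <ᵇ z)

is001 : ℕ → ℕ → ℕ → Bool
is001 x y z = (x ≡ᵇ y) ∧ (y <ᵇ z)

orderIso-012 : ∀ x y z → orderIso (x ∷ y ∷ z ∷ []) (0 ∷ 1 ∷ 2 ∷ []) ≡ is012 x y z
orderIso-012 = comparisonInvariant-≡ (orderIso₃-invariant 0 1 2)
  (λ (s , t , _) → cong₂ _∧_ (lt s) (lt t))
  (toWitness {a? = all? λ a → all? λ b → all? λ c → _ Bool.≟ _} tt)

orderIso-001 : ∀ x y z → orderIso (x ∷ y ∷ z ∷ []) (0 ∷ 0 ∷ 1 ∷ []) ≡ is001 x y z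
orderIso-001 = comparisonInvariant-≡ (orderIso₃-invariant 0 0 1)
  (λ (s , t , _) → cong₂ _∧_ (eq s) (lt t))
  (toWitness {a? = all? λ a → all? λ b → all? λ c → _ Bool.≟ _} tt)

hasPair : (ℕ → ℕ → Bool) → List ℕ → Bool
hasPair t []       = false
hasPair t (y ∷ ys) = any (t y) ys ∨ hasPair t ys

hasTriple : (ℕ → ℕ → ℕ → Bool) → List ℕ → Bool
hasTriple t []       = false
hasTriple t (x ∷ xs) = hasPair (t x) xs ∨ hasTriple t xs

any-++ : ∀ {A : Set} (f : A → Bool) xs ys → any f (xs ++ ys) ≡ any f xs ∨ any f ys
any-++ f []       ys = refl
any-++ f (x ∷ xs) ys = trans (cong (f x ∨_) (any-++ f xs ys)) (sym (∨-assoc (f x) (any f xs) (any f ys)))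

any-map : ∀ {A B : Set} (f : B → Bool) (g : A → B) xs → any f (map g xs) ≡ any (f ∘ g) xs
any-map f g []       = refl
any-map f g (x ∷ xs) = cong (f (g x) ∨_) (any-map f g xs)

any-subseqs-∷ : ∀ (f : List ℕ → Bool) k x xs →
  any f (subseqs (suc k) (x ∷ xs)) ≡ any (f ∘ (x ∷_)) (subseqs k xs) ∨ any f (subseqs (suc k) xs)
any-subseqs-∷ f k x xs =
  trans (any-++ f (map (x ∷_) (subseqs k xs)) _) (cong (_∨ _) (any-map f (x ∷_) (subseqs k xs)))

any-subseqs₁ : ∀ {f g} → (∀ z → f (z ∷ []) ≡ g z) → ∀ zs → any f (subseqs 1 zs) ≡ any g zs
any-subseqs₁ e []       = refl
any-subseqs₁ e (z ∷ zs) = cong₂ _∨_ (e z) (any-subseqs₁ e zs)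

any-subseqs₂ : ∀ {f t} → (∀ y z → f (y ∷ z ∷ []) ≡ t y z) →
  ∀ ys → any f (subseqs 2 ys) ≡ hasPair t ys
any-subseqs₂ e []           = refl
any-subseqs₂ {f} e (y ∷ ys) =
  trans (any-subseqs-∷ f 1 y ys) (cong₂ _∨_ (any-subseqs₁ (e y) ys) (any-subseqs₂ e ys))

any-subseqs₃ : ∀ {f t} → (∀ x y z → f (x ∷ y ∷ z ∷ []) ≡ t x y z) →
  ∀ xs → any f (subseqs 3 xs) ≡ hasTriple t xs
any-subseqs₃ e []           = refl
any-subseqs₃ {f} e (x ∷ xs) =
  trans (any-subseqs-∷ f 2 x xs) (cong₂ _∨_ (any-subseqs₂ (e x) xs) (any-subseqs₃ e xs))

count : ∀ {A : Set} → (A → Bool) → List A → ℕ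
count f []       = 0
count f (x ∷ xs) = (if f x then 1 else 0) + count f xs

length-filter-filter : ∀ {A : Set} (f g : A → Bool) xs →
  length (filter (λ x → T? (f x)) (filter (λ x → T? (g x)) xs)) ≡ count (λ x → g x ∧ f x) xs
length-filter-filter f g [] = refl
length-filter-filter f g (x ∷ xs) with g x
... | false = length-filter-filter f g xs
... | true with f x
...   | true  = cong suc (length-filter-filter f g xs)
...   | false = length-filter-filter f g xs

count-cong : ∀ {A : Set} {f g : A → Bool} → (∀ x → f x ≡ g x) → ∀ xs → count f xs ≡ count g xs
count-cong e []       = refl
count-cong e (x ∷ xs) rewrite e x = cong (_ +_) (count-cong e xs)

count-false : ∀ {A : Set} {f : A → Bool} → (∀ x → f x ≡ false) → ∀ xs → count f xs ≡ 0
count-false e []       = refl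
count-false e (x ∷ xs) rewrite e x = count-false e xs

count-++ : ∀ {A : Set} (f : A → Bool) xs ys → count f (xs ++ ys) ≡ count f xs + count f ys
count-++ f []       ys = refl
count-++ f (x ∷ xs) ys rewrite count-++ f xs ys = sym (+-assoc (if f x then 1 else 0) (count f xs) (count f ys))

count-map : ∀ {A B : Set} (f : B → Bool) (g : A → B) xs → count f (map g xs) ≡ count (f ∘ g) xs
count-map f g []       = refl
count-map f g (x ∷ xs) = cong (_ +_) (count-map f g xs)

∑ : ℕ → (ℕ → ℕ) → ℕ
∑ zero    f = 0
∑ (suc n) f = f 0 + ∑ n (f ∘ suc)

syntax ∑ n (λ i → e) = ∑[ i < n ] e

∑-cong : ∀ n {f g : ℕ → ℕ} → (∀ i → i < n → f i ≡ g i) → ∑ n f ≡ ∑ n g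
∑-cong zero    e = refl
∑-cong (suc n) e = cong₂ _+_ (e 0 z<s) (∑-cong n (λ i i<n → e (suc i) (s<s i<n)))

∑-zero : ∀ n {f : ℕ → ℕ} → (∀ i → i < n → f i ≡ 0) → ∑ n f ≡ 0
∑-zero zero    e = refl
∑-zero (suc n) e rewrite e 0 z<s = ∑-zero n (λ i i<n → e (suc i) (s<s i<n))

∑-+ : ∀ n (f g : ℕ → ℕ) → ∑[ i < n ] (f i + g i) ≡ ∑ n f + ∑ n g
∑-+ zero    f g = refl
∑-+ (suc n) f g rewrite ∑-+ n (f ∘ suc) (g ∘ suc) = interchange (f 0) (g 0) (∑ n (f ∘ suc)) (∑ n (g ∘ suc))

∑-*ʳ : ∀ n (f : ℕ → ℕ) c → ∑[ i < n ] (f i * c) ≡ ∑ n f * c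
∑-*ʳ zero    f c = refl
∑-*ʳ (suc n) f c rewrite ∑-*ʳ n (f ∘ suc) c = sym (*-distribʳ-+ c (f 0) _)

∑-last : ∀ n (f : ℕ → ℕ) → ∑ (suc n) f ≡ ∑ n f + f n
∑-last zero    f = +-comm (f 0) 0
∑-last (suc n) f rewrite ∑-last n (f ∘ suc) = sym (+-assoc (f 0) _ _)

∑-+-range : ∀ a b (f : ℕ → ℕ) → ∑ (a + b) f ≡ ∑ a f + ∑[ i < b ] f (a + i)
∑-+-range zero    b f = refl
∑-+-range (suc a) b f rewrite ∑-+-range a b (f ∘ suc) = sym (+-assoc (f 0) _ _)

∑-cutoff : ∀ {m v} (f g : ℕ → ℕ) {X} → v < m →
  (∀ i → i < v → f i ≡ g i) → f v ≡ X → (∀ i → v < i → i < m → f i ≡ 0) →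
  ∑ m f ≡ ∑ v g + X
∑-cutoff {v = v} f g {X} v<m below at above with m≤n⇒∃[o]m+o≡n v<m
... | r , refl = begin
  ∑ (suc v + r) f                              ≡⟨ ∑-+-range (suc v) r f ⟩
  ∑ (suc v) f + ∑[ i < r ] f (suc v + i)       ≡⟨ cong₂ _+_ (∑-last v f) (∑-zero r vanish) ⟩
  (∑ v f + f v) + 0                            ≡⟨ +-identityʳ _ ⟩
  ∑ v f + f v                                  ≡⟨ cong₂ _+_ (∑-cong v below) at ⟩
  ∑ v g + X                                    ∎
  where
  open ≡-Reasoning
  vanish : ∀ i → i < r → f (suc v + i) ≡ 0
  vanish i i<r = above (suc v + i) (s≤s (m≤m+n v i)) (+-monoʳ-< (suc v) i<r)

count-wordsOver : ∀ (f : List ℕ → Bool) m n →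
  count f (wordsOver m (suc n)) ≡ ∑[ i < m ] count (λ w → f (i ∷ w)) (wordsOver m n)
count-wordsOver f m n = prefixes (λ i → i) m
  where
  L = wordsOver m n
  prefixes : ∀ (g : ℕ → ℕ) m →
    count f (concatMap (λ x → map (x ∷_) L) (applyUpTo g m)) ≡ ∑[ i < m ] count (λ w → f (g i ∷ w)) L
  prefixes g zero    = refl
  prefixes g (suc m) = trans (count-++ f (map (g 0 ∷_) L) _)
    (cong₂ _+_ (count-map f (g 0 ∷_) L) (prefixes (g ∘ suc) m))

_choose_ : ℕ → ℕ → ℕ
_     choose zero  = 1
zero  choose suc k = 0
suc n choose suc k = n choose k + n choose suc k

twice : ℕ → ℕ
twice zero    = 0
twice (suc k) = suc (suc (twice k))

twice≡+ : ∀ k → twice k ≡ k + k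
twice≡+ zero    = refl
twice≡+ (suc k) = cong suc (trans (cong suc (twice≡+ k)) (sym (+-suc k k)))

∑-choose : ∀ n a → ∑[ i < n ] (i choose a) ≡ n choose suc a
∑-choose zero    a = refl
∑-choose (suc n) a rewrite ∑-last n (_choose a) | ∑-choose n a = +-comm (n choose suc a) (n choose a)

∑-choose-* : ∀ a b n → ∑[ i < suc n ] (i choose a * (n ∸ i) choose b) ≡ suc n choose suc (a + b)
∑-choose-* a zero n = begin
  ∑[ i < suc n ] (i choose a * 1) ≡⟨ ∑-cong (suc n) (λ i _ → *-identityʳ (i choose a)) ⟩
  ∑[ i < suc n ] (i choose a)     ≡⟨ ∑-choose (suc n) a ⟩
  suc n choose suc a              ≡⟨ cong (λ b → suc n choose suc b) (sym (+-identityʳ a)) ⟩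
  suc n choose suc (a + 0)        ∎
  where open ≡-Reasoning
∑-choose-* a (suc b) zero rewrite *-zeroʳ (0 choose a) | +-suc a b = refl
∑-choose-* a (suc b) (suc n) = begin
  ∑[ i < suc (suc n) ] (i choose a * (suc n ∸ i) choose suc b)
    ≡⟨ ∑-last (suc n) (λ i → i choose a * (suc n ∸ i) choose suc b) ⟩
  ∑[ i < suc n ] (i choose a * (suc n ∸ i) choose suc b) + suc n choose a * (n ∸ n) choose suc b
    ≡⟨ cong₂ _+_ (∑-cong (suc n) pascal) (cong (λ m → suc n choose a * m choose suc b) (n∸n≡0 n)) ⟩
  ∑[ i < suc n ] (i choose a * (n ∸ i) choose b + i choose a * (n ∸ i) choose suc b) + suc n choose a * 0
    ≡⟨ cong₂ _+_ (∑-+ (suc n) (λ i → i choose a * (n ∸ i) choose b)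
                              (λ i → i choose a * (n ∸ i) choose suc b))
                 (*-zeroʳ (suc n choose a)) ⟩
  (∑[ i < suc n ] (i choose a * (n ∸ i) choose b) +
   ∑[ i < suc n ] (i choose a * (n ∸ i) choose suc b)) + 0
    ≡⟨ +-identityʳ _ ⟩
  ∑[ i < suc n ] (i choose a * (n ∸ i) choose b) +
  ∑[ i < suc n ] (i choose a * (n ∸ i) choose suc b)
    ≡⟨ cong₂ _+_ (∑-choose-* a b n) (∑-choose-* a (suc b) n) ⟩
  suc n choose suc (a + b) + suc n choose suc (a + suc b)
    ≡⟨ cong (λ m → suc n choose suc (a + b) + suc n choose suc m) (+-suc a b) ⟩
  suc (suc n) choose suc (suc (a + b))
    ≡⟨ cong (λ m → suc (suc n) choose suc m) (sym (+-suc a b)) ⟩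
  suc (suc n) choose suc (a + suc b) ∎
  where
  open ≡-Reasoning
  pascal : ∀ i → i < suc n → i choose a * (suc n ∸ i) choose suc b ≡
                              i choose a * (n ∸ i) choose b + i choose a * (n ∸ i) choose suc b
  pascal i (s≤s i≤n) rewrite +-∸-assoc 1 i≤n = *-distribˡ-+ (i choose a) _ _

avoiderCount : ℕ → ℕ → ℕ
avoiderCount zero    k = 0 choose k
avoiderCount (suc n) k = suc n choose suc (twice k)

c-empty : ∀ p q r k → c (p ∷ q ∷ r ∷ []) 0 k ≡ 0 choose k
c-empty p q r zero    = refl
c-empty p q r (suc k) = refl

avoidingAfter0 : (ℕ → ℕ → ℕ → Bool) → ℕ → List ℕ → Bool
avoidingAfter0 t k w = catalanFrom 0 w ∧ (not (hasTriple t (0 ∷ w)) ∧ (des (0 ∷ w) ≡ᵇ k))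

c-suc : ∀ {p q r} t → (∀ x y z → orderIso (x ∷ y ∷ z ∷ []) (p ∷ q ∷ r ∷ []) ≡ t x y z) →
  ∀ n k → c (p ∷ q ∷ r ∷ []) (suc n) k ≡ count (avoidingAfter0 t k) (wordsOver (suc n) n)
c-suc {p} {q} {r} t iso n k = begin
  c (p ∷ q ∷ r ∷ []) (suc n) k
    ≡⟨ length-filter-filter (λ w → avoids w (p ∷ q ∷ r ∷ []) ∧ (des w ≡ᵇ k)) isCatalan
                            (wordsOver (suc n) (suc n)) ⟩
  count isAvoider (wordsOver (suc n) (suc n))
    ≡⟨ count-wordsOver isAvoider (suc n) n ⟩
  count (isAvoider ∘ (0 ∷_)) W + ∑[ i < n ] count (isAvoider ∘ (suc i ∷_)) W
    ≡⟨ cong₂ _+_ (count-cong (λ w → cong (λ b → catalanFrom 0 w ∧ (not b ∧ _))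
                                         (any-subseqs₃ iso (0 ∷ w))) W)
                 (∑-zero n (λ i _ → count-false (λ _ → refl) W)) ⟩
  count (avoidingAfter0 t k) W + 0
    ≡⟨ +-identityʳ _ ⟩
  count (avoidingAfter0 t k) W ∎
  where
  open ≡-Reasoning
  W = wordsOver (suc n) n
  isAvoider : List ℕ → Bool
  isAvoider w = isCatalan w ∧ (avoids w (p ∷ q ∷ r ∷ []) ∧ (des w ≡ᵇ k))

-- Pattern 012

binary : List ℕ → Bool
binary = all (_<ᵇ 2)

binary⇒catalanFrom : ∀ v w → T (binary w) → catalanFrom v w ≡ true
binary⇒catalanFrom v []                  _ = refl
binary⇒catalanFrom v (0 ∷ xs)            h = binary⇒catalanFrom 0 xs h
binary⇒catalanFrom v (1 ∷ xs)            h = binary⇒catalanFrom 1 xs h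
binary⇒catalanFrom v (suc (suc x) ∷ xs) ()

is012-binary : ∀ x y z → T (y <ᵇ 2) → T (z <ᵇ 2) → is012 x y z ≡ false
is012-binary x 0             z             _ _ = refl
is012-binary x 1             0             _ _ = ∧-zeroʳ (x <ᵇ 1)
is012-binary x 1             1             _ _ = ∧-zeroʳ (x <ᵇ 1)
is012-binary x 1             (suc (suc z)) _ ()
is012-binary x (suc (suc y)) z             () _

any-is012-binary : ∀ x y zs → T (y <ᵇ 2) → T (binary zs) → any (is012 x y) zs ≡ false
any-is012-binary x y []       _  _ = refl
any-is012-binary x y (z ∷ zs) hy h with T-∧⁻ (z <ᵇ 2) h
... | hz , hzs rewrite is012-binary x y z hy hz = any-is012-binary x y zs hy hzs

hasPair-is012-binary : ∀ x ys → T (binary ys) → hasPair (is012 x) ys ≡ false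
hasPair-is012-binary x []       _ = refl
hasPair-is012-binary x (y ∷ ys) h with T-∧⁻ (y <ᵇ 2) h
... | hy , hys rewrite any-is012-binary x y ys hy hys = hasPair-is012-binary x ys hys

binary-avoids-012 : ∀ w → T (binary w) → hasTriple is012 w ≡ false
binary-avoids-012 []       _ = refl
binary-avoids-012 (x ∷ xs) h with T-∧⁻ (x <ᵇ 2) h
... | _ , hxs rewrite hasPair-is012-binary x xs hxs = binary-avoids-012 xs hxs

nonbinary⇒012-from-01 : ∀ zs → binary zs ≡ false → any (is012 0 1) zs ≡ true
nonbinary⇒012-from-01 (0 ∷ zs)           h = nonbinary⇒012-from-01 zs h
nonbinary⇒012-from-01 (1 ∷ zs)           h = nonbinary⇒012-from-01 zs h
nonbinary⇒012-from-01 (suc (suc z) ∷ zs) h = refl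

nonbinary⇒012-from-0 : ∀ w → catalanFrom 0 w ≡ true → binary w ≡ false → hasPair (is012 0) w ≡ true
nonbinary⇒012-from-0 (0 ∷ ys) cat nb rewrite nonbinary⇒012-from-0 ys cat nb = ∨-zeroʳ _
nonbinary⇒012-from-0 (1 ∷ ys) cat nb rewrite nonbinary⇒012-from-01 ys nb = refl

catalan-avoids-012≡binary : ∀ w → catalanFrom 0 w ∧ not (hasTriple is012 (0 ∷ w)) ≡ binary w
catalan-avoids-012≡binary w with binary w in bin
... | true rewrite binary⇒catalanFrom 0 w (subst T (sym bin) tt)
                 | binary-avoids-012 (0 ∷ w) (subst T (sym bin) tt) = refl
... | false with catalanFrom 0 w in cat
...   | false = refl
...   | true rewrite nonbinary⇒012-from-0 w cat bin = refl

binaryCount : ℕ → ℕ → ℕ → ℕ → ℕ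
binaryCount m n b k = count (λ w → binary w ∧ (des (b ∷ w) ≡ᵇ k)) (wordsOver m n)

binaryCount-suc : ∀ m n b k → binaryCount (2 + m) (suc n) b k ≡
  count (λ w → binary w ∧ (des (b ∷ 0 ∷ w) ≡ᵇ k)) (wordsOver (2 + m) n) +
  count (λ w → binary w ∧ (des (b ∷ 1 ∷ w) ≡ᵇ k)) (wordsOver (2 + m) n)
binaryCount-suc m n b k = begin
  count f (wordsOver (2 + m) (suc n))
    ≡⟨ count-wordsOver f (2 + m) n ⟩
  startingWith 0 + (startingWith 1 + ∑[ i < m ] count (λ w → f (suc (suc i) ∷ w)) W)
    ≡⟨ cong (startingWith 0 +_) (cong (startingWith 1 +_) (∑-zero m (λ i _ → count-false (λ _ → refl) W))) ⟩
  startingWith 0 + (startingWith 1 + 0)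
    ≡⟨ cong (startingWith 0 +_) (+-identityʳ (startingWith 1)) ⟩
  startingWith 0 + startingWith 1 ∎
  where
  open ≡-Reasoning
  W = wordsOver (2 + m) n
  f : List ℕ → Bool
  f w = binary w ∧ (des (b ∷ w) ≡ᵇ k)
  startingWith : ℕ → ℕ
  startingWith x = count (λ w → binary w ∧ (des (b ∷ x ∷ w) ≡ᵇ k)) W

binaryCount-closed : ∀ m n k →
  binaryCount (2 + m) n 0 k ≡ suc n choose suc (twice k) × binaryCount (2 + m) n 1 k ≡ suc n choose twice k
binaryCount-closed m zero    zero    = refl , refl
binaryCount-closed m zero    (suc k) = refl , refl
binaryCount-closed m (suc n) k       = startingWith0 , startingWith1 k
  where
  W = wordsOver (2 + m) n
  startingWith0 : binaryCount (2 + m) (suc n) 0 k ≡ suc (suc n) choose suc (twice k)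
  startingWith0 = trans (binaryCount-suc m n 0 k)
    (trans (cong₂ _+_ (proj₁ (binaryCount-closed m n k)) (proj₂ (binaryCount-closed m n k)))
                 (+-comm (suc n choose suc (twice k)) (suc n choose twice k)))
  startingWith1 : ∀ k → binaryCount (2 + m) (suc n) 1 k ≡ suc (suc n) choose twice k
  startingWith1 zero = trans (binaryCount-suc m n 1 0)
    (cong₂ _+_ (count-false {f = λ w → binary w ∧ false} (λ w → ∧-zeroʳ (binary w)) W)
               (proj₂ (binaryCount-closed m n 0)))
  startingWith1 (suc k) = trans (binaryCount-suc m n 1 (suc k))
    (cong₂ _+_ (proj₁ (binaryCount-closed m n k)) (proj₂ (binaryCount-closed m n (suc k))))

c-012 : ∀ n k → c (0 ∷ 1 ∷ 2 ∷ []) n k ≡ avoiderCount n k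
c-012 zero    k = c-empty 0 1 2 k
c-012 (suc n) k = begin
  c (0 ∷ 1 ∷ 2 ∷ []) (suc n) k
    ≡⟨ c-suc is012 orderIso-012 n k ⟩
  count (avoidingAfter0 is012 k) (wordsOver (suc n) n)
    ≡⟨ count-cong (λ w → trans (sym (∧-assoc (catalanFrom 0 w) _ _))
                               (cong (_∧ (des (0 ∷ w) ≡ᵇ k)) (catalan-avoids-012≡binary w))) (wordsOver (suc n) n) ⟩
  binaryCount (suc n) n 0 k
    ≡⟨ closed n ⟩
  suc n choose suc (twice k) ∎
  where
  open ≡-Reasoning
  closed : ∀ n → binaryCount (suc n) n 0 k ≡ suc n choose suc (twice k)
  closed zero    = proj₁ (binaryCount-closed 0 0 k)
  closed (suc n) = proj₁ (binaryCount-closed n (suc n) k)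

-- Pattern 001

any-is001 : ∀ a y zs → any (is001 a y) zs ≡ (a ≡ᵇ y) ∧ any (y <ᵇ_) zs
any-is001 a y []       = sym (∧-zeroʳ (a ≡ᵇ y))
any-is001 a y (z ∷ zs) = trans (cong (is001 a y z ∨_) (any-is001 a y zs))
                               (sym (∧-distribˡ-∨ (a ≡ᵇ y) (y <ᵇ z) (any (y <ᵇ_) zs)))

anyBelow : ℕ → (ℕ → Bool) → Bool
anyBelow zero    f = false
anyBelow (suc n) f = anyBelow n f ∨ f n

anyBelow-intro : ∀ (f : ℕ → Bool) {n a} → a < n → T (f a) → T (anyBelow n f)
anyBelow-intro f {suc n} a<1+n fa with m<1+n⇒m<n∨m≡n a<1+n
... | inj₁ a<n  = T-∨ˡ (f n) (anyBelow-intro f a<n fa)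
... | inj₂ refl = T-∨ʳ (anyBelow n f) fa

anyBelow-elim : ∀ (f : ℕ → Bool) n → T (anyBelow n f) → Σ[ a ∈ ℕ ] a < n × T (f a)
anyBelow-elim f (suc n) h with T-∨⁻ (anyBelow n f) h
... | inj₁ below with anyBelow-elim f n below
...   | a , a<n , fa = a , m<n⇒m<1+n a<n , fa
anyBelow-elim f (suc n) h | inj₂ fn = n , n<1+n n , fn

anyBelow-false : ∀ n → anyBelow n (λ _ → false) ≡ false
anyBelow-false zero    = refl
anyBelow-false (suc n) rewrite anyBelow-false n = refl

anyBelow-cong : ∀ n {f g : ℕ → Bool} → (∀ a → a < n → f a ≡ g a) → anyBelow n f ≡ anyBelow n g
anyBelow-cong zero    e = refl
anyBelow-cong (suc n) e = cong₂ _∨_ (anyBelow-cong n (λ a a<n → e a (m<n⇒m<1+n a<n))) (e n (n<1+n n))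

nonIncreasingFrom : ℕ → List ℕ → Bool
nonIncreasingFrom v []       = true
nonIncreasingFrom v (y ∷ ys) = (y <ᵇ suc v) ∧ nonIncreasingFrom y ys

nonIncreasing⇒catalanFrom : ∀ v w → T (nonIncreasingFrom v w) → T (catalanFrom v w)
nonIncreasing⇒catalanFrom v []       _ = tt
nonIncreasing⇒catalanFrom v (y ∷ ys) h with T-∧⁻ (y <ᵇ suc v) h
... | y≤v , rest rewrite <⇒<ᵇ≡true (m<n⇒m<1+n (<ᵇ⇒< y (suc v) y≤v)) = nonIncreasing⇒catalanFrom y ys rest

-- The word 0 1 … j followed by w contains 001. Since 0 1 … j has distinct letters, an
-- occurrence meets it at most in its first letter, which can then be any a ≤ j.
contains001After : ℕ → List ℕ → Bool
contains001After j w = anyBelow (suc j) (λ a → hasPair (is001 a) w) ∨ hasTriple is001 w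

contains001After-[] : ∀ j → contains001After j [] ≡ false
contains001After-[] j = cong (_∨ false) (anyBelow-false (suc j))

contains001After-climb : ∀ j w → contains001After j (suc j ∷ w) ≡ contains001After (suc j) w
contains001After-climb j w =
  trans (cong (_∨ (hasPair (is001 (suc j)) w ∨ hasTriple is001 w)) (anyBelow-cong (suc j) noPairThroughTop))
        (sym (∨-assoc (anyBelow (suc j) (λ a → hasPair (is001 a) w)) _ _))
  where
  noPairThroughTop : ∀ a → a < suc j → hasPair (is001 a) (suc j ∷ w) ≡ hasPair (is001 a) w
  noPairThroughTop a a<1+j =
    cong (_∨ hasPair (is001 a) w)
         (trans (any-is001 a (suc j) w) (cong (_∧ any (suc j <ᵇ_) w) (<⇒≡ᵇ≡false a<1+j)))

contains001After-shift : ∀ j x y ys → y ≤ x → x ≤ j →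
  contains001After j (x ∷ y ∷ ys) ≡ contains001After j (y ∷ ys)
contains001After-shift j x y ys y≤x x≤j = T-injective forward backward
  where
  L = y ∷ ys
  pairsIn : List ℕ → ℕ → Bool
  pairsIn w a = hasPair (is001 a) w
  -- a letter z > x after x also exceeds y, and y y z is an occurrence with the first y in the prefix
  riseAfterX : T (any (x <ᵇ_) L) → T (contains001After j L)
  riseAfterX h = T-∨ˡ (hasTriple is001 L)
    (anyBelow-intro (pairsIn L) (s≤s (≤-trans y≤x x≤j)) (T-∨ˡ (hasPair (is001 y) ys) yyz))
    where
    riseInTail : T (any (x <ᵇ_) ys)
    riseInTail = subst (λ b → T (b ∨ any (x <ᵇ_) ys)) (≥⇒<ᵇ≡false y≤x) h
    yyz : T (any (is001 y y) ys)
    yyz = subst T (sym (trans (any-is001 y y ys) (cong (_∧ any (y <ᵇ_) ys) (n≡ᵇn≡true y))))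
            (T-any-mono {f = x <ᵇ_} (λ z x<z → <⇒<ᵇ (≤-<-trans y≤x (<ᵇ⇒< x z x<z))) ys riseInTail)
  forward : T (contains001After j (x ∷ L)) → T (contains001After j L)
  forward h with T-∨⁻ (anyBelow (suc j) (pairsIn (x ∷ L))) h
  ... | inj₁ prefixed with anyBelow-elim (pairsIn (x ∷ L)) (suc j) prefixed
  ...   | a , a≤j , occ with T-∨⁻ (any (is001 a x) L) occ
  ...     | inj₁ throughX = riseAfterX (proj₂ (T-∧⁻ (a ≡ᵇ x) (subst T (any-is001 a x L) throughX)))
  ...     | inj₂ inL      = T-∨ˡ (hasTriple is001 L) (anyBelow-intro (pairsIn L) a≤j inL)
  forward h | inj₂ unprefixed with T-∨⁻ (pairsIn L x) unprefixed
  ... | inj₁ fromX = T-∨ˡ (hasTriple is001 L) (anyBelow-intro (pairsIn L) (s≤s x≤j) fromX)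
  ... | inj₂ inL   = T-∨ʳ (anyBelow (suc j) (pairsIn L)) inL
  backward : T (contains001After j L) → T (contains001After j (x ∷ L))
  backward h with T-∨⁻ (anyBelow (suc j) (pairsIn L)) h
  ... | inj₂ inL      = T-∨ʳ (anyBelow (suc j) (pairsIn (x ∷ L))) (T-∨ʳ (pairsIn L x) inL)
  ... | inj₁ prefixed with anyBelow-elim (pairsIn L) (suc j) prefixed
  ...   | a , a≤j , occ = T-∨ˡ (hasTriple is001 (x ∷ L))
                            (anyBelow-intro (pairsIn (x ∷ L)) a≤j (T-∨ʳ (any (is001 a x) L) occ))

contains001After-descend : ∀ j x w → x ≤ j → contains001After j (x ∷ w) ≡ not (nonIncreasingFrom x w)
contains001After-descend j x []       _   = contains001After-[] j
contains001After-descend j x (y ∷ ys) x≤j with y ≤? x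
... | yes y≤x rewrite <⇒<ᵇ≡true (s≤s y≤x) =
  trans (contains001After-shift j x y ys y≤x x≤j) (contains001After-descend j y ys (≤-trans y≤x x≤j))
... | no y≰x rewrite ≥⇒<ᵇ≡false (≰⇒> y≰x) = T-injective (λ _ → tt) (λ _ → xxy)
  where
  xxy : T (contains001After j (x ∷ y ∷ ys))
  xxy = T-∨ˡ _ (anyBelow-intro (λ a → hasPair (is001 a) (x ∷ y ∷ ys)) (s≤s x≤j)
          (T-∨ˡ _ (T-∨ˡ _ (subst T (sym (cong₂ _∧_ (n≡ᵇn≡true x) (<⇒<ᵇ≡true (≰⇒> y≰x)))) tt))))

nonIncreasingTail : ℕ → ℕ → List ℕ → Bool
nonIncreasingTail v k w = nonIncreasingFrom v w ∧ (des (v ∷ w) ≡ᵇ k)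

avoiding001Tail : ℕ → ℕ → List ℕ → Bool
avoiding001Tail j k w = catalanFrom j w ∧ (not (contains001After j w) ∧ (des (j ∷ w) ≡ᵇ k))

nonIncreasingTail-descent : ∀ v k x w → x < v →
  nonIncreasingTail v k (x ∷ w) ≡ nonIncreasingFrom x w ∧ (suc (des (x ∷ w)) ≡ᵇ k)
nonIncreasingTail-descent v k x w x<v rewrite <⇒<ᵇ≡true (m<n⇒m<1+n x<v) | <⇒<ᵇ≡true x<v = refl

nonIncreasingTail-stay : ∀ v k w → nonIncreasingTail v k (v ∷ w) ≡ nonIncreasingTail v k w
nonIncreasingTail-stay v k w rewrite <⇒<ᵇ≡true (n<1+n v) | n<ᵇn≡false v = refl

nonIncreasingTail-rise : ∀ v k x w → v < x → nonIncreasingTail v k (x ∷ w) ≡ false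
nonIncreasingTail-rise v k x w v<x rewrite ≥⇒<ᵇ≡false {x} {suc v} v<x = refl

avoiding001Tail-descend : ∀ j k x w → x ≤ j → avoiding001Tail j k (x ∷ w) ≡ nonIncreasingTail j k (x ∷ w)
avoiding001Tail-descend j k x w x≤j
  rewrite <⇒<ᵇ≡true (s≤s (m≤n⇒m≤1+n x≤j)) | <⇒<ᵇ≡true (s≤s x≤j)
        | contains001After-descend j x w x≤j | not-involutive (nonIncreasingFrom x w)
        = ∧-redundantˡ _ (nonIncreasing⇒catalanFrom x w)

avoiding001Tail-climb : ∀ j k w → avoiding001Tail j k (suc j ∷ w) ≡ avoiding001Tail (suc j) k w
avoiding001Tail-climb j k w
  rewrite <⇒<ᵇ≡true (n<1+n j) | ≥⇒<ᵇ≡false (n≤1+n j) | contains001After-climb j w = refl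

avoiding001Tail-jump : ∀ j k x w → suc j < x → avoiding001Tail j k (x ∷ w) ≡ false
avoiding001Tail-jump j k x w 1+j<x rewrite ≥⇒<ᵇ≡false {x} {suc (suc j)} 1+j<x = refl

-- Such a tail is determined by which k of its n steps are descents and by the k distinct
-- values below v that it descends to.
count-nonIncreasingTail : ∀ m n v k → v < m →
  count (nonIncreasingTail v k) (wordsOver m n) ≡ v choose k * n choose k
count-nonIncreasingTail m zero    v zero    _ = refl
count-nonIncreasingTail m zero    v (suc k) _ = sym (*-zeroʳ (v choose suc k))
count-nonIncreasingTail m (suc n) v zero    v<m = begin
  count (nonIncreasingTail v 0) (wordsOver m (suc n))
    ≡⟨ count-wordsOver (nonIncreasingTail v 0) m n ⟩
  ∑[ i < m ] count (λ w → nonIncreasingTail v 0 (i ∷ w)) W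
    ≡⟨ ∑-cutoff _ (λ _ → 0) v<m
         (λ i i<v → count-false (λ w → trans (nonIncreasingTail-descent v 0 i w i<v) (∧-zeroʳ _)) W)
         (count-cong (nonIncreasingTail-stay v 0) W)
         (λ i v<i _ → count-false (λ w → nonIncreasingTail-rise v 0 i w v<i) W) ⟩
  ∑[ i < v ] 0 + count (nonIncreasingTail v 0) W
    ≡⟨ cong₂ _+_ (∑-zero v (λ _ _ → refl)) (count-nonIncreasingTail m n v 0 v<m) ⟩
  1 ∎
  where
  open ≡-Reasoning
  W = wordsOver m n
count-nonIncreasingTail m (suc n) v (suc k) v<m = begin
  count (nonIncreasingTail v (suc k)) (wordsOver m (suc n))
    ≡⟨ count-wordsOver (nonIncreasingTail v (suc k)) m n ⟩
  ∑[ i < m ] count (λ w → nonIncreasingTail v (suc k) (i ∷ w)) W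
    ≡⟨ ∑-cutoff _ (λ i → count (nonIncreasingTail i k) W) v<m
         (λ i i<v → count-cong (λ w → nonIncreasingTail-descent v (suc k) i w i<v) W)
         (count-cong (nonIncreasingTail-stay v (suc k)) W)
         (λ i v<i _ → count-false (λ w → nonIncreasingTail-rise v (suc k) i w v<i) W) ⟩
  ∑[ i < v ] count (nonIncreasingTail i k) W + count (nonIncreasingTail v (suc k)) W
    ≡⟨ cong₂ _+_ (∑-cong v (λ i i<v → count-nonIncreasingTail m n i k (<-trans i<v v<m)))
                 (count-nonIncreasingTail m n v (suc k) v<m) ⟩
  ∑[ i < v ] (i choose k * n choose k) + v choose suc k * n choose suc k
    ≡⟨ cong (_+ v choose suc k * n choose suc k) (trans (∑-*ʳ v (_choose k) (n choose k))
                                                         (cong (_* n choose k) (∑-choose v k))) ⟩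
  v choose suc k * n choose k + v choose suc k * n choose suc k
    ≡⟨ *-distribˡ-+ (v choose suc k) (n choose k) (n choose suc k) ⟨
  v choose suc k * suc n choose suc k ∎
  where
  open ≡-Reasoning
  W = wordsOver m n

count-avoiding001Tail-suc : ∀ m n j k → suc j < m →
  count (avoiding001Tail j k) (wordsOver m (suc n)) ≡
  j choose k * suc n choose k + count (avoiding001Tail (suc j) k) (wordsOver m n)
count-avoiding001Tail-suc m n j k 1+j<m = begin
  count (avoiding001Tail j k) (wordsOver m (suc n))
    ≡⟨ count-wordsOver (avoiding001Tail j k) m n ⟩
  ∑[ i < m ] count (λ w → avoiding001Tail j k (i ∷ w)) W
    ≡⟨ ∑-cutoff _ startingWith 1+j<m
         (λ i i≤j → count-cong (λ w → avoiding001Tail-descend j k i w (≤-pred i≤j)) W)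
         (count-cong (avoiding001Tail-climb j k) W)
         (λ i 1+j<i _ → count-false (λ w → avoiding001Tail-jump j k i w 1+j<i) W) ⟩
  ∑ (suc j) startingWith + count (avoiding001Tail (suc j) k) W
    ≡⟨ cong (_+ count (avoiding001Tail (suc j) k) W) descending ⟩
  j choose k * suc n choose k + count (avoiding001Tail (suc j) k) W ∎
  where
  open ≡-Reasoning
  W = wordsOver m n
  j<m = <-trans (n<1+n j) 1+j<m
  startingWith : ℕ → ℕ
  startingWith i = count (λ w → nonIncreasingTail j k (i ∷ w)) W
  descending : ∑ (suc j) startingWith ≡ j choose k * suc n choose k
  descending = begin
    ∑ (suc j) startingWith        ≡⟨ ∑-last j startingWith ⟩
    ∑ j startingWith + startingWith j
      ≡⟨ ∑-cutoff startingWith startingWith j<m (λ _ _ → refl) refl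
           (λ i j<i _ → count-false (λ w → nonIncreasingTail-rise j k i w j<i) W) ⟨
    ∑ m startingWith              ≡⟨ count-wordsOver (nonIncreasingTail j k) m n ⟨
    count (nonIncreasingTail j k) (wordsOver m (suc n))
      ≡⟨ count-nonIncreasingTail m (suc n) j k j<m ⟩
    j choose k * suc n choose k   ∎

count-avoiding001Tail : ∀ m n j k → j + n < m →
  count (avoiding001Tail j k) (wordsOver m n) ≡ ∑[ i < suc n ] ((j + i) choose k * (n ∸ i) choose k)
count-avoiding001Tail m zero j zero _ rewrite contains001After-[] j = refl
count-avoiding001Tail m zero j (suc k) _ rewrite contains001After-[] j | *-zeroʳ ((j + 0) choose suc k) = refl
count-avoiding001Tail m (suc n) j k j+[1+n]<m = begin
  count (avoiding001Tail j k) (wordsOver m (suc n))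
    ≡⟨ count-avoiding001Tail-suc m n j k (≤-<-trans (s≤s (m≤m+n j n)) 1+j+n<m) ⟩
  j choose k * suc n choose k + count (avoiding001Tail (suc j) k) (wordsOver m n)
    ≡⟨ cong₂ _+_ (cong (λ i → i choose k * suc n choose k) (sym (+-identityʳ j)))
                 (count-avoiding001Tail m n (suc j) k 1+j+n<m) ⟩
  (j + 0) choose k * suc n choose k + ∑[ i < suc n ] ((suc j + i) choose k * (n ∸ i) choose k)
    ≡⟨ cong ((j + 0) choose k * suc n choose k +_)
            (∑-cong (suc n) (λ i _ → cong (λ a → a choose k * (n ∸ i) choose k) (sym (+-suc j i)))) ⟩
  ∑[ i < suc (suc n) ] ((j + i) choose k * (suc n ∸ i) choose k) ∎
  where
  open ≡-Reasoning
  1+j+n<m : suc (j + n) < m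
  1+j+n<m = subst (_< m) (+-suc j n) j+[1+n]<m

c-001 : ∀ n k → c (0 ∷ 0 ∷ 1 ∷ []) n k ≡ avoiderCount n k
c-001 zero    k = c-empty 0 0 1 k
c-001 (suc n) k = begin
  c (0 ∷ 0 ∷ 1 ∷ []) (suc n) k                     ≡⟨ c-suc is001 orderIso-001 n k ⟩
  count (avoiding001Tail 0 k) (wordsOver (suc n) n) ≡⟨ count-avoiding001Tail (suc n) n 0 k (n<1+n n) ⟩
  ∑[ i < suc n ] (i choose k * (n ∸ i) choose k)    ≡⟨ ∑-choose-* k k n ⟩
  suc n choose suc (k + k)                          ≡⟨ cong (λ m → suc n choose suc m) (twice≡+ k) ⟨
  suc n choose suc (twice k)                        ∎
  where open ≡-Reasoning

-- The generating function

open import Data.Integer as ℤ using (ℤ; +_)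
open import Data.Integer.Tactic.RingSolver using (solve-∀)

-- With b = C(n+1,1), Pascal's rule gives C(n+3,1) = 1 + (1 + b) and C(n+2,1) = 1 + b.
second-difference₀ : ∀ (b : ℤ) → ((+ 1 ℤ.+ (+ 1 ℤ.+ b)) ℤ.- (+ 2 ℤ.* (+ 1 ℤ.+ b))) ℤ.+ b ≡ + 0
second-difference₀ = solve-∀

-- With a, b, c = C(n+1,2k+1), C(n+1,2k+2), C(n+1,2k+3), Pascal's rule gives
-- C(n+3,2k+3) = (a + b) + (b + c) and C(n+2,2k+3) = b + c.
second-difference : ∀ (a b c : ℤ) →
  ((((a ℤ.+ b) ℤ.+ (b ℤ.+ c)) ℤ.- (+ 2 ℤ.* (b ℤ.+ c))) ℤ.+ c) ℤ.- a ≡ + 0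
second-difference = solve-∀

denomTimesC≡numer : ∀ p → (∀ n k → c p n k ≡ avoiderCount n k) → ∀ n k → denomTimesC p n k ≡ numer n k
denomTimesC≡numer p h 0 zero          rewrite h 0 0 = refl
denomTimesC≡numer p h 0 (suc k)       rewrite h 0 (suc k) = refl
denomTimesC≡numer p h 1 zero          rewrite h 1 0 | h 0 0 = refl
denomTimesC≡numer p h 1 (suc k)       rewrite h 1 (suc k) | h 0 (suc k) = refl
denomTimesC≡numer p h 2 zero          rewrite h 2 0 | h 1 0 | h 0 0 = refl
denomTimesC≡numer p h 2 1             rewrite h 2 1 | h 1 1 | h 0 1 | h 0 0 = refl
denomTimesC≡numer p h 2 (suc (suc k)) rewrite h 2 (2 + k) | h 1 (2 + k) | h 0 (2 + k) | h 0 (suc k) = refl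
denomTimesC≡numer p h (suc (suc (suc n))) zero
  rewrite h (3 + n) 0 | h (2 + n) 0 | h (1 + n) 0 = second-difference₀ (+ (suc n choose 1))
denomTimesC≡numer p h (suc (suc (suc n))) (suc k)
  rewrite h (3 + n) (suc k) | h (2 + n) (suc k) | h (1 + n) (suc k) | h (1 + n) k =
  second-difference (+ (suc n choose suc (twice k))) (+ (suc n choose suc (suc (twice k))))
                    (+ (suc n choose suc (suc (suc (twice k)))))

theorem4 : (p : List ℕ) → (p ≡ 0 ∷ 1 ∷ 2 ∷ [] ⊎ p ≡ 0 ∷ 0 ∷ 1 ∷ []) →
    (n k : ℕ) → denomTimesC p n k ≡ numer n k
theorem4 p (inj₁ refl) = denomTimesC≡numer p c-012
theorem4 p (inj₂ refl) = denomTimesC≡numer p c-001
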